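{- Let $n\ge 2$ and let $\pi$ be an involution of $\{1,\dots,n\}$ whose associated labelled Motzkin path $(M,\lambda)$ is irreducible and has the maximal labelling. Then $\pi(1)=n$ and $\pi(n)=1$; that is, $\pi = n\,\pi'\,1$ where $\pi'$ (the entries at positions $2,\dots,n-1$) is an involution of $\{2,\dots,n-1\}$.
   Context: For an involution $\pi$ of $\{1,\dots,n\}$, its associated labelled Motzkin path $(M,\lambda)$ has steps $s_1\cdots s_n$ with $s_i=H$ if $\pi(i)=i$, $s_i=U$ if $\pi(i)>i$, $s_i=D$ if $\pi(i)<i$. Each down step $s_i$ has height $h(s_i)=\#\{j<i:\pi(j)\ge i\}$ (the height of the path before the step) and label $\lambda(s_i)$ equal to the rank of $\pi(i)$ in increasing order among the still-open up steps, i.e. $\lambda(s_i)=1+\#\{j<\pi(i):\pi(j)>i\}$; one has $1\le\lambda(s_i)\le h(s_i)$. The labelling is maximal if $\lambda(s_i)=h(s_i)$ for every down step $s_i$. The path $M$ is irreducible if it touches the $x$-axis only at its starting and ending points, i.e. the height after each of the first $n-1$ steps is positive. -}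

module Defs where

open import Data.Nat using (ℕ; zero; suc; _+_; _<_; _≤_)
open import Data.Fin using (Fin; toℕ) renaming (zero to fzero; suc to fsuc)
open import Data.Fin.Properties using (_<?_; _≤?_)
open import Relation.Nullary using (Dec; yes; no)
open import Relation.Binary.PropositionalEquality using (_≡_)
open import Data.Product using (_×_)
open import Relation.Nullary.Decidable using (_×-dec_)

count : ∀ {n} {P : Fin n → Set} → ((i : Fin n) → Dec (P i)) → ℕ
count {zero} d = 0
count {suc n} d with d fzero
... | yes _ = suc (count (λ i → d (fsuc i)))
... | no _ = count (λ i → d (fsuc i))

-- positions are 0-indexed: position i : Fin n stands for i+1 ∈ {1,…,n}

IsInvolution : ∀ {n} → (Fin n → Fin n) → Set
IsInvolution {n} π = (i : Fin n) → π (π i) ≡ i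

IsDown : ∀ {n} → (Fin n → Fin n) → Fin n → Set
IsDown π i = π i Data.Fin.< i

heightBefore : ∀ {n} → (Fin n → Fin n) → Fin n → ℕ
heightBefore π i = count (λ j → dec j)
  where
    dec : ∀ j → Dec ((j Data.Fin.< i) × (i Data.Fin.≤ π j))
    dec j = (j <? i) ×-dec (i ≤? π j)

label : ∀ {n} → (Fin n → Fin n) → Fin n → ℕ
label π i = suc (count (λ j → dec j))
  where
    dec : ∀ j → Dec ((j Data.Fin.< π i) × (i Data.Fin.< π j))
    dec j = (j <? π i) ×-dec (i <? π j)

heightAfter : ∀ {n} → (Fin n → Fin n) → Fin n → ℕ
heightAfter π i = count (λ j → dec j)
  where
    dec : ∀ j → Dec ((j Data.Fin.≤ i) × (i Data.Fin.< π j))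
    dec j = (j ≤? i) ×-dec (i <? π j)

MaximalLabelling : ∀ {n} → (Fin n → Fin n) → Set
MaximalLabelling π = ∀ i → IsDown π i → label π i ≡ heightBefore π i

Irreducible : ∀ {n} → (Fin n → Fin n) → Set
Irreducible {n} π = ∀ (i : Fin n) → suc (toℕ i) < n → 0 < heightAfter π i

-- If π(1) = m were not n, irreducibility at m would give an arc j ↦ π(j) with
-- j < m < π(j), and j ≠ 1. The down step at m, closing the arc from 1, then lies
-- below two open arcs, so its height is at least 2; but its label is 1, since it
-- closes the leftmost open arc. This contradicts maximality of the labelling.
module Submission where

open import Defs
open import Data.Nat as ℕ using (ℕ; zero; suc; _∸_; z≤n; s≤s)
open import Data.Nat.Properties as ℕ using (n≮0)
open import Data.Fin using (Fin; toℕ; _<_; _≤_) renaming (zero to fzero; suc to fsuc)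
open import Data.Fin.Properties using (toℕ-injective; toℕ<n; ≤∧≢⇒<; <-trans)
open import Data.Product using (_×_; _,_; ∃)
open import Data.Empty using (⊥-elim)
open import Relation.Nullary using (Dec; yes; no; ¬_)
open import Relation.Binary.PropositionalEquality using (_≡_; _≢_; refl; sym; trans; cong; subst; module ≡-Reasoning)
open import Function using (_∘_)

count-∄ : ∀ {n} {P : Fin n → Set} (d : ∀ i → Dec (P i)) → (∀ i → ¬ P i) → count d ≡ 0
count-∄ {zero}  d ∄P = refl
count-∄ {suc n} d ∄P with d fzero
... | yes p = ⊥-elim (∄P fzero p)
... | no _  = count-∄ (λ i → d (fsuc i)) (λ i → ∄P (fsuc i))

count>0⇒∃ : ∀ {n} {P : Fin n → Set} (d : ∀ i → Dec (P i)) → 0 ℕ.< count d → ∃ P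
count>0⇒∃ {suc n} d pos with d fzero
... | yes p = fzero , p
... | no _ with count>0⇒∃ (λ i → d (fsuc i)) pos
...   | i , p = fsuc i , p

count≥1 : ∀ {n} {P : Fin n → Set} (d : ∀ i → Dec (P i)) (a : Fin n) → P a → 1 ℕ.≤ count d
count≥1 d fzero pa with d fzero
... | yes _ = s≤s z≤n
... | no ¬pa = ⊥-elim (¬pa pa)
count≥1 d (fsuc a) pa with d fzero
... | yes _ = s≤s z≤n
... | no _  = count≥1 (λ i → d (fsuc i)) a pa

count≥2 : ∀ {n} {P : Fin n → Set} (d : ∀ i → Dec (P i)) (a b : Fin n) →
          a < b → P a → P b → 2 ℕ.≤ count d
count≥2 d fzero (fsuc b) _ pa pb with d fzero
... | yes _ = s≤s (count≥1 (λ i → d (fsuc i)) b pb)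
... | no ¬pa = ⊥-elim (¬pa pa)
count≥2 d (fsuc a) (fsuc b) (s≤s a<b) pa pb with d fzero
... | yes _ = ℕ.m≤n⇒m≤1+n (count≥2 (λ i → d (fsuc i)) a b a<b pa pb)
... | no _  = count≥2 (λ i → d (fsuc i)) a b a<b pa pb

module _ {n : ℕ} (π : Fin n → Fin n) where

  heightAfter>0⇒openArc : ∀ i → 0 ℕ.< heightAfter π i → ∃ λ j → j ≤ i × i < π j
  heightAfter>0⇒openArc i = count>0⇒∃ _

  label≡1-closingFirst : ∀ {i} → toℕ (π i) ≡ 0 → label π i ≡ 1
  label≡1-closingFirst {i} πi≡0 = cong suc (count-∄ _ noneBelow)
    where
    noneBelow : ∀ j → ¬ (j < π i × i < π j)
    noneBelow j (j<πi , _) = n≮0 (subst (toℕ j ℕ.<_) πi≡0 j<πi)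

  heightBefore≥2 : ∀ {i} (a b : Fin n) → a < b → b < i →
                   i ≤ π a → i ≤ π b → 2 ℕ.≤ heightBefore π i
  heightBefore≥2 a b a<b b<i i≤πa i≤πb =
    count≥2 _ a b a<b (<-trans a<b b<i , i≤πa) (b<i , i≤πb)

module _ {n : ℕ} (π : Fin (suc n) → Fin (suc n)) (inv : IsInvolution π) (irr : Irreducible π) where

  fzero<partnerOfFirst : 0 ℕ.< n → fzero {n} < π fzero
  fzero<partnerOfFirst 0<n with heightAfter>0⇒openArc π fzero (irr fzero (s≤s 0<n))
  ... | fzero , _ , 0<π0 = 0<π0

  -- Irreducibility at π(1) yields an arc opened before π(1) and closed after it;
  -- it cannot start at 1 or at π(1), since those positions are matched to each other.
  secondArcOverPartnerOfFirst : toℕ (π fzero) ℕ.< n →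
    ∃ λ j → fzero {n} < j × j < π fzero × π fzero < π j
  secondArcOverPartnerOfFirst m<n with heightAfter>0⇒openArc π (π fzero) (irr (π fzero) (s≤s m<n))
  ... | j , j≤m , m<πj = j , ≤∧≢⇒< z≤n (j≢fzero ∘ sym) , ≤∧≢⇒< j≤m j≢m , m<πj
    where
    j≢fzero : j ≢ fzero
    j≢fzero refl = ℕ.<-irrefl refl m<πj
    j≢m : j ≢ π fzero
    j≢m refl = n≮0 (subst (λ k → toℕ (π fzero) ℕ.< toℕ k) (inv fzero) m<πj)

  partnerOfFirst≡last : MaximalLabelling π → toℕ (π fzero) ≡ n
  partnerOfFirst≡last maxl with toℕ (π fzero) ℕ.≟ n
  ... | yes m≡n = m≡n
  ... | no m≢n = ⊥-elim (ℕ.<-irrefl refl (subst (2 ℕ.≤_) height≡1 2≤height))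
    where
    m<n : toℕ (π fzero) ℕ.< n
    m<n = ℕ.≤∧≢⇒< (ℕ.s≤s⁻¹ (toℕ<n (π fzero))) m≢n
    πm≡fzero : π (π fzero) ≡ fzero
    πm≡fzero = inv fzero
    down : IsDown π (π fzero)
    down = subst (_< π fzero) (sym πm≡fzero) (fzero<partnerOfFirst (ℕ.≤-<-trans z≤n m<n))
    height≡1 : heightBefore π (π fzero) ≡ 1
    height≡1 = trans (sym (maxl (π fzero) down)) (label≡1-closingFirst π (cong toℕ πm≡fzero))
    2≤height : 2 ℕ.≤ heightBefore π (π fzero)
    2≤height with secondArcOverPartnerOfFirst m<n
    ... | j , 0<j , j<m , m<πj = heightBefore≥2 π fzero j 0<j j<m ℕ.≤-refl (ℕ.<⇒≤ m<πj)

proposition5p2 : (n : ℕ) → 2 ℕ.≤ n → (π : Fin n → Fin n) →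
    IsInvolution π → Irreducible π → MaximalLabelling π →
    (first last : Fin n) → toℕ first ≡ 0 → toℕ last ≡ n ∸ 1 →
    (π first ≡ last) × (π last ≡ first)
proposition5p2 zero () _
proposition5p2 (suc n) _ π inv irr maxl first last first≡0 last≡n = π-first≡last , π-last≡first
  where
  open ≡-Reasoning
  π-first≡last : π first ≡ last
  π-first≡last = toℕ-injective (begin
    toℕ (π first)  ≡⟨ cong (toℕ ∘ π) (toℕ-injective first≡0) ⟩
    toℕ (π fzero)  ≡⟨ partnerOfFirst≡last π inv irr maxl ⟩
    n              ≡⟨ sym last≡n ⟩
    toℕ last       ∎)
  π-last≡first : π last ≡ first
  π-last≡first = trans (cong π (sym π-first≡last)) (inv first)
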